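{- Let $n=n_1+n_2$ with $n_2\ge n_1\ge 0$, and with $n$ and $n_2-n_1$ even. Then the number $B_n$ of distinct Boolean functions on $n$ variables given by construction (K) with parameters $n_1,n_2$ (every one of which is a bent function) equals $$B_n=(b_{n_2-n_1})^{2^{n_1}}\cdot \widetilde{N}_{n_2}^{\,n_2-n_1},$$ where $b_{k}$ is the number of bent functions on $k$ variables and $\widetilde{N}_{n_2}^{\,n_2-n_1}$ is the number of ordered partitions of $F_2^{n_2}$ into $2^{n_1}$ affine subspaces of dimension $n_2-n_1$.
   Context: $F_2=\{0,1\}$ and $F_2^m$ is the vector space with coordinatewise addition $\oplus$ mod 2. An affine subspace of dimension $k$ is a set $a\oplus S$ with $S$ a $k$-dimensional linear subspace. For $x,u\in F_2^m$, $\langle u,x\rangle=\bigoplus_i u_ix_i$. For a Boolean function $f:F_2^m\to F_2$, its Walsh transform is $W_f(u)=\sum_{x\in F_2^m}(-1)^{\langle u,x\rangle\oplus f(x)}$, and the support of its Walsh spectrum is $\{u: W_f(u)\ne 0\}$. $f$ is bent if $|W_f(u)|=2^{m/2}$ for all $u$; $f$ is plateaued if all its Walsh coefficients lie in $\{0,\pm 2^{k}\}$ for some integer $k$. For $a\in F_2$ write $a^1=a$, $a^0=a\oplus 1$, and for $x,a\in F_2^{m}$ write $x^a=x_1^{a_1}\cdots x_m^{a_m}$ (so $x^a=1$ iff $x=a$). Construction (K) with parameters $n_1,n_2$: choose an ordered partition $\{C_a\}_{a\in F_2^{n_1}}$ of $F_2^{n_2}$ into affine subspaces $C_a$ of dimension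 $n_2-n_1$, and for each $a$ choose a plateaued function $f_a:F_2^{n_2}\to F_2$ whose Walsh spectrum support is exactly $C_a$; then set $f(x,y)=\bigoplus_{a\in F_2^{n_1}} f_a(y)x^a$ for $x\in F_2^{n_1}$, $y\in F_2^{n_2}$. -}

module Defs where

open import Data.Bool using (Bool; true; false; _xor_; _∧_; not; if_then_else_)
open import Data.Nat using (ℕ; zero; suc; _+_; _∸_; _^_)
open import Data.Integer using (ℤ; +_; -_; _*_) renaming (_+_ to _+ℤ_)
open import Data.Fin using (Fin)
open import Data.Vec using (Vec; []; _∷_; zipWith; replicate; _++_)
open import Data.List using (List; []; _∷_; map; concatMap; foldr)
open import Data.Product using (Σ; ∃; ∃-syntax; _×_; _,_)
open import Data.Sum using (_⊎_)
open import Relation.Binary.PropositionalEquality using (_≡_; _≢_)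
open import Function.Bundles using (_⇔_)

BV : ℕ → Set
BV m = Vec Bool m

BF : ℕ → Set
BF m = BV m → Bool

_⊕_ : ∀ {m} → BV m → BV m → BV m
_⊕_ = zipWith _xor_

𝟎 : ∀ {m} → BV m
𝟎 = replicate _ false

⟨_,_⟩ : ∀ {m} → BV m → BV m → Bool
⟨ [] , [] ⟩ = false
⟨ u ∷ us , x ∷ xs ⟩ = (u ∧ x) xor ⟨ us , xs ⟩

allBV : (m : ℕ) → List (BV m)
allBV zero = [] ∷ []
allBV (suc m) = concatMap (λ v → (false ∷ v) ∷ (true ∷ v) ∷ []) (allBV m)

sign : Bool → ℤ
sign false = + 1
sign true  = - (+ 1)

W : ∀ {m} → BF m → BV m → ℤ
W {m} f u = foldr _+ℤ_ (+ 0) (map (λ x → sign (⟨ u , x ⟩ xor f x)) (allBV m))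

-- bent: |W_f(u)| = 2^(m/2) for all u, i.e. W_f(u)^2 = 2^m
Bent : (m : ℕ) → BF m → Set
Bent m f = ∀ u → W f u * W f u ≡ + (2 ^ m)

Plateaued : (m : ℕ) → BF m → Set
Plateaued m f = ∃[ k ] ∀ u → (W f u ≡ + 0) ⊎ (W f u ≡ + (2 ^ k)) ⊎ (W f u ≡ - (+ (2 ^ k)))

lincomb : ∀ {m k} → BV k → Vec (BV m) k → BV m
lincomb [] [] = 𝟎
lincomb (c ∷ cs) (v ∷ vs) = (if c then v else 𝟎) ⊕ lincomb cs vs

LinIndep : ∀ {m k} → Vec (BV m) k → Set
LinIndep {m} {k} vs = ∀ (c : BV k) → lincomb c vs ≡ 𝟎 → c ≡ 𝟎

Subset : ℕ → Set
Subset m = BV m → Bool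

IsAffine : (m k : ℕ) → Subset m → Set
IsAffine m k C = Σ (BV m) λ a → Σ (Vec (BV m) k) λ vs → LinIndep vs ×
  (∀ y → (C y ≡ true) ⇔ (∃[ c ] y ≡ a ⊕ lincomb c vs))

OrdPartition : (n₁ n₂ : ℕ) → (BV n₁ → Subset n₂) → Set
OrdPartition n₁ n₂ C =
  (∀ a → IsAffine n₂ (n₂ ∸ n₁) (C a)) ×
  (∀ y → ∃[ a ] (C a y ≡ true × (∀ a′ → C a′ y ≡ true → a′ ≡ a)))

-- x^a = Π_i x_i^{a_i}  (x_i^1 = x_i, x_i^0 = x_i ⊕ 1)
pw : ∀ {m} → BV m → BV m → Bool
pw [] [] = true
pw (x ∷ xs) (a ∷ as) = (if a then x else not x) ∧ pw xs as

constrK : ∀ {n₁ n₂} → (BV n₁ → BF n₂) → BV n₁ → BV n₂ → Bool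
constrK {n₁} fs x y = foldr _xor_ false (map (λ a → fs a y ∧ pw x a) (allBV n₁))

IsK : (n₁ n₂ : ℕ) → BF (n₁ + n₂) → Set
IsK n₁ n₂ g = Σ (BV n₁ → Subset n₂) λ C → Σ (BV n₁ → BF n₂) λ fs →
  OrdPartition n₁ n₂ C ×
  (∀ a → Plateaued n₂ (fs a) × (∀ u → (W (fs a) u ≢ + 0) ⇔ (C a u ≡ true))) ×
  (∀ x y → g (x ++ y) ≡ constrK fs x y)

_≈_ : ∀ {A B : Set} → (A → B) → (A → B) → Set
f ≈ g = ∀ x → f x ≡ g x

-- "P has exactly k elements up to the equivalence R"
HasCard : {A : Set} → (A → A → Set) → (A → Set) → ℕ → Set
HasCard {A} R P k = Σ (Fin k → A) λ xs →
  (∀ i → P (xs i)) ×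
  (∀ i j → R (xs i) (xs j) → i ≡ j) ×
  (∀ x → P x → ∃[ i ] R x (xs i))

_≈P_ : ∀ {n₁ n₂} → (BV n₁ → Subset n₂) → (BV n₁ → Subset n₂) → Set
C ≈P D = ∀ a y → C a y ≡ D a y

-- A function on F₂^{n₂} whose Walsh support is exactly an affine space a₀ ⊕ ⟨v₁,…,v_k⟩ of dimension
-- k = n₂ − n₁ has, by Walsh inversion, the form y ↦ ⟨a₀, y⟩ ⊕ h(⟨v₁, y⟩, …, ⟨v_k, y⟩) for a unique
-- h on k variables, with W(a₀ ⊕ Σ cᵢvᵢ) = 2^{n₁} W_h(c); Parseval then shows that it is plateaued
-- exactly when h is bent. Hence the functions of (K) correspond bijectively to pairs (ordered
-- partition, family of 2^{n₁} bent functions), and they are bent because W_f(u, v) = ±W_{f_a}(v)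
-- for the unique block C_a containing v.

module Submission where

open import Defs
open import Data.Nat using (ℕ; _+_; _∸_; _^_; _*_; _≤_)
open import Data.Nat.Divisibility using (_∣_)
open import Data.Product using (_×_)

open import Algebra.Bundles using (AbelianGroup; CommutativeRing; CommutativeSemigroup)
open import Algebra.Structures using (IsAbelianGroup; IsCommutativeMonoid)
import Algebra.Properties.AbelianGroup as AbelianGroupProperties
import Algebra.Properties.CommutativeSemigroup as CommutativeSemigroupProperties
open import Data.Bool using (Bool; true; false; _xor_; _∧_; not; if_then_else_)
import Data.Bool.Properties as BoolP
open import Data.Fin using (Fin)
import Data.Fin as Fin
import Data.Fin.Properties as FinP
open import Data.Integer using (ℤ; +_; -_; -[1+_]; ∣_∣) renaming (_+_ to _+ℤ_; _*_ to _*ℤ_)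
import Data.Integer.Properties as ℤ
open import Data.Integer.Tactic.RingSolver using (solve-∀)
open import Data.List using (foldr; map; concatMap)
import Data.List as List
import Data.Nat as ℕ
open import Data.Nat.Divisibility using (divides)
import Data.Nat.Properties as ℕ
open import Data.Product using (∃; ∃-syntax; _,_; proj₁; proj₂; uncurry)
open import Data.Product.Relation.Binary.Pointwise.NonDependent using (Pointwise)
open import Data.Sum using (_⊎_; inj₁; inj₂)
open import Data.Unit using (⊤)
open import Data.Vec using (Vec; []; _∷_; _++_)
import Data.Vec as Vec
import Data.Vec.Properties as VecP
open import Function using (id; _∘_)
open import Function.Bundles using (_⇔_; Equivalence; mk⇔)
open import Relation.Binary.Definitions using (DecidableEquality; tri<; tri≈; tri>)
open import Relation.Binary.PropositionalEquality
open import Relation.Nullary using (Dec; yes; no; does; contradiction)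
import Relation.Nullary.Decidable as Dec
open import Relation.Nullary.Decidable using (_⊎-dec_)
open import Relation.Unary using (_⟨×⟩_)
import Relation.Unary as U

private
  variable
    m : ℕ

⊕-comm : ∀ (x y : BV m) → x ⊕ y ≡ y ⊕ x
⊕-comm []       []       = refl
⊕-comm (x ∷ xs) (y ∷ ys) = cong₂ _∷_ (BoolP.xor-comm x y) (⊕-comm xs ys)

⊕-self : ∀ (x : BV m) → x ⊕ x ≡ 𝟎
⊕-self []       = refl
⊕-self (x ∷ xs) = cong₂ _∷_ (BoolP.xor-same x) (⊕-self xs)

⊕-isAbelianGroup : IsAbelianGroup _≡_ (_⊕_ {m}) 𝟎 id
⊕-isAbelianGroup = record
  { isGroup = record
    { isMonoid = record
      { isSemigroup = record
        { isMagma = record { isEquivalence = isEquivalence ; ∙-cong = cong₂ _⊕_ }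
        ; assoc   = VecP.zipWith-assoc BoolP.xor-assoc
        }
      ; identity = VecP.zipWith-identityˡ BoolP.xor-identityˡ , VecP.zipWith-identityʳ BoolP.xor-identityʳ
      }
    ; inverse = ⊕-self , ⊕-self
    ; ⁻¹-cong = id
    }
  ; comm = ⊕-comm
  }

⊕-abelianGroup : ℕ → AbelianGroup _ _
⊕-abelianGroup m = record { isAbelianGroup = ⊕-isAbelianGroup {m} }

module ⊕ {m : ℕ} where
  open AbelianGroup (⊕-abelianGroup m) public using (identityˡ; identityʳ)
  open AbelianGroupProperties (⊕-abelianGroup m) public
  open CommutativeSemigroupProperties (AbelianGroup.commutativeSemigroup (⊕-abelianGroup m)) public
    using (interchange)

module xor where
  open CommutativeSemigroupProperties (CommutativeRing.+-commutativeSemigroup BoolP.xor-∧-commutativeRing) public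
    using (interchange)

_≟ᵥ_ : DecidableEquality (BV m)
_≟ᵥ_ = VecP.≡-dec BoolP._≟_

⟨⟩-comm : ∀ (u x : BV m) → ⟨ u , x ⟩ ≡ ⟨ x , u ⟩
⟨⟩-comm []       []       = refl
⟨⟩-comm (u ∷ us) (x ∷ xs) = cong₂ _xor_ (BoolP.∧-comm u x) (⟨⟩-comm us xs)

⟨⟩-⊕ʳ : ∀ (u x y : BV m) → ⟨ u , x ⊕ y ⟩ ≡ ⟨ u , x ⟩ xor ⟨ u , y ⟩
⟨⟩-⊕ʳ []       []       []       = refl
⟨⟩-⊕ʳ (u ∷ us) (x ∷ xs) (y ∷ ys) =
  trans (cong₂ _xor_ (BoolP.∧-distribˡ-xor u x y) (⟨⟩-⊕ʳ us xs ys))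
        (xor.interchange (u ∧ x) (u ∧ y) _ _)

⟨⟩-⊕ˡ : ∀ (u v x : BV m) → ⟨ u ⊕ v , x ⟩ ≡ ⟨ u , x ⟩ xor ⟨ v , x ⟩
⟨⟩-⊕ˡ u v x = begin
  ⟨ u ⊕ v , x ⟩            ≡⟨ ⟨⟩-comm (u ⊕ v) x ⟩
  ⟨ x , u ⊕ v ⟩            ≡⟨ ⟨⟩-⊕ʳ x u v ⟩
  ⟨ x , u ⟩ xor ⟨ x , v ⟩  ≡⟨ cong₂ _xor_ (⟨⟩-comm x u) (⟨⟩-comm x v) ⟩
  ⟨ u , x ⟩ xor ⟨ v , x ⟩  ∎
  where open ≡-Reasoning

⟨⟩-𝟎ʳ : ∀ (u : BV m) → ⟨ u , 𝟎 ⟩ ≡ false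
⟨⟩-𝟎ʳ []       = refl
⟨⟩-𝟎ʳ (u ∷ us) = trans (cong (_xor ⟨ us , 𝟎 ⟩) (BoolP.∧-zeroʳ u)) (⟨⟩-𝟎ʳ us)

⟨⟩-𝟎ˡ : ∀ (u : BV m) → ⟨ 𝟎 , u ⟩ ≡ false
⟨⟩-𝟎ˡ u = trans (⟨⟩-comm 𝟎 u) (⟨⟩-𝟎ʳ u)

⟨⟩-++ : ∀ {n} (u x : BV m) (v y : BV n) → ⟨ u ++ v , x ++ y ⟩ ≡ ⟨ u , x ⟩ xor ⟨ v , y ⟩
⟨⟩-++ []       []       v y = refl
⟨⟩-++ (u ∷ us) (x ∷ xs) v y =
  trans (cong ((u ∧ x) xor_) (⟨⟩-++ us xs v y)) (sym (BoolP.xor-assoc (u ∧ x) _ _))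

coords : ∀ {k} → Vec (BV m) k → BV m → BV k
coords vs y = Vec.map (λ v → ⟨ v , y ⟩) vs

⟨⟩-lincomb : ∀ {k} (c : BV k) (vs : Vec (BV m) k) y → ⟨ lincomb c vs , y ⟩ ≡ ⟨ c , coords vs y ⟩
⟨⟩-lincomb []       []       y = ⟨⟩-𝟎ˡ y
⟨⟩-lincomb (c ∷ cs) (v ∷ vs) y =
  trans (⟨⟩-⊕ˡ (if c then v else 𝟎) (lincomb cs vs) y) (cong₂ _xor_ (scaled c) (⟨⟩-lincomb cs vs y))
  where
  scaled : ∀ c → ⟨ (if c then v else 𝟎) , y ⟩ ≡ c ∧ ⟨ v , y ⟩
  scaled false = ⟨⟩-𝟎ˡ y
  scaled true  = refl

lincomb-⊕ : ∀ {k} (c d : BV k) (vs : Vec (BV m) k) → lincomb (c ⊕ d) vs ≡ lincomb c vs ⊕ lincomb d vs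
lincomb-⊕ []       []       []       = sym (⊕.identityʳ 𝟎)
lincomb-⊕ (c ∷ cs) (d ∷ ds) (v ∷ vs) =
  trans (cong₂ _⊕_ (scaled-xor c d) (lincomb-⊕ cs ds vs)) (⊕.interchange _ _ _ _)
  where
  scaled-xor : ∀ c d → (if c xor d then v else 𝟎) ≡ (if c then v else 𝟎) ⊕ (if d then v else 𝟎)
  scaled-xor false d     = sym (⊕.identityˡ _)
  scaled-xor true  false = sym (⊕.identityʳ v)
  scaled-xor true  true  = sym (⊕-self v)

lincomb-injective : ∀ {k} {vs : Vec (BV m) k} → LinIndep vs → ∀ c d → lincomb c vs ≡ lincomb d vs → c ≡ d
lincomb-injective {vs = vs} indep c d eq = ⊕.x∙y⁻¹≈ε⇒x≈y c d (indep (c ⊕ d) (begin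
  lincomb (c ⊕ d) vs            ≡⟨ lincomb-⊕ c d vs ⟩
  lincomb c vs ⊕ lincomb d vs   ≡⟨ cong (_⊕ lincomb d vs) eq ⟩
  lincomb d vs ⊕ lincomb d vs   ≡⟨ ⊕-self _ ⟩
  𝟎                             ∎))
  where open ≡-Reasoning

xor-cancelˡ : ∀ p q → p xor (p xor q) ≡ q
xor-cancelˡ false q = refl
xor-cancelˡ true  q = BoolP.not-involutive q

sign-xor : ∀ p q → sign (p xor q) ≡ sign p *ℤ sign q
sign-xor false q     = sym (ℤ.*-identityˡ (sign q))
sign-xor true  false = refl
sign-xor true  true  = refl

sign-sq : ∀ p → sign p *ℤ sign p ≡ + 1
sign-sq false = refl
sign-sq true  = refl

sign-injective : ∀ {p q} → sign p ≡ sign q → p ≡ q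
sign-injective {false} {false} _ = refl
sign-injective {true}  {true}  _ = refl

sign-not : ∀ p → sign p +ℤ sign (not p) ≡ + 0
sign-not false = refl
sign-not true  = refl

pow2 : ℕ → ℤ
pow2 m = + (2 ^ m)

pow2-+ : ∀ m n → pow2 (m + n) ≡ pow2 m *ℤ pow2 n
pow2-+ m n = trans (cong +_ (ℕ.^-distribˡ-+-* 2 m n)) (ℤ.pos-* (2 ^ m) (2 ^ n))

pow2≢0 : ∀ m → pow2 m ≢ + 0
pow2≢0 m eq = ℕ.≢-nonZero⁻¹ (2 ^ m) {{ℕ.m^n≢0 2 m}} (ℤ.+-injective eq)

pow2-cancelˡ : ∀ m {i j} → pow2 m *ℤ i ≡ pow2 m *ℤ j → i ≡ j
pow2-cancelˡ m {i} {j} = ℤ.*-cancelˡ-≡ (pow2 m) i j {{ℕ.m^n≢0 2 m}}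

pow2-cancelʳ : ∀ m {i j} → i *ℤ pow2 m ≡ j *ℤ pow2 m → i ≡ j
pow2-cancelʳ m {i} {j} = ℤ.*-cancelʳ-≡ i j (pow2 m) {{ℕ.m^n≢0 2 m}}

pow2-injective : ∀ {m n} → pow2 m ≡ pow2 n → m ≡ n
pow2-injective {m} {n} eq with ℕ.<-cmp m n
... | tri< m<n _ _ = contradiction (ℤ.+-injective eq) (ℕ.<⇒≢ (ℕ.^-monoʳ-< 2 (ℕ.n<1+n 1) m<n))
... | tri≈ _ m≡n _ = m≡n
... | tri> _ _ n<m = contradiction (sym (ℤ.+-injective eq)) (ℕ.<⇒≢ (ℕ.^-monoʳ-< 2 (ℕ.n<1+n 1) n<m))

square-injective : ∀ {m n} → m * m ≡ n * n → m ≡ n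
square-injective {m} {n} eq with ℕ.<-cmp m n
... | tri< m<n _ _ = contradiction eq (ℕ.<⇒≢ (ℕ.*-mono-< m<n m<n))
... | tri≈ _ m≡n _ = m≡n
... | tri> _ _ n<m = contradiction (sym eq) (ℕ.<⇒≢ (ℕ.*-mono-< n<m n<m))

i*i≡n*n⇒i≡±n : ∀ i n → i *ℤ i ≡ + n *ℤ + n → i ≡ + n ⊎ i ≡ - + n
i*i≡n*n⇒i≡±n i n eq = ±∣_∣ i (square-injective (begin
  ∣ i ∣ ℕ.* ∣ i ∣       ≡⟨ ℤ.abs-* i i ⟨
  ∣ i *ℤ i ∣             ≡⟨ cong ∣_∣ eq ⟩
  ∣ + n *ℤ + n ∣         ≡⟨ ℤ.abs-* (+ n) (+ n) ⟩
  n ℕ.* n               ∎))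
  where
  open ≡-Reasoning
  ±∣_∣ : ∀ i → ∣ i ∣ ≡ n → i ≡ + n ⊎ i ≡ - + n
  ±∣ + _    ∣ refl = inj₁ refl
  ±∣ -[1+ _ ] ∣ refl = inj₂ refl

±pow2-square : ∀ {i} e → i ≡ pow2 e ⊎ i ≡ - pow2 e → i *ℤ i ≡ pow2 (e + e)
±pow2-square e (inj₁ refl) = sym (pow2-+ e e)
±pow2-square e (inj₂ refl) = trans (neg-square (pow2 e)) (sym (pow2-+ e e))
  where
  neg-square : ∀ x → (- x) *ℤ (- x) ≡ x *ℤ x
  neg-square = solve-∀

±pow2≢0 : ∀ {i} e → i ≡ pow2 e ⊎ i ≡ - pow2 e → i ≢ + 0
±pow2≢0 e (inj₁ refl) = pow2≢0 e
±pow2≢0 e (inj₂ refl) = pow2≢0 e ∘ ℤ.neg-injective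

negative : ℤ → Bool
negative (+ _)      = false
negative -[1+ _ ]   = true

negative-pow2*sign : ∀ n b → negative (pow2 n *ℤ sign b) ≡ b
negative-pow2*sign n false = cong negative (ℤ.*-identityʳ (pow2 n))
negative-pow2*sign n true  = negative-nonzero (2 ^ n) {{ℕ.m^n≢0 2 n}}
  where
  negative-nonzero : ∀ x .{{_ : ℕ.NonZero x}} → negative (+ x *ℤ - + 1) ≡ true
  negative-nonzero (ℕ.suc x) = refl

module BigOperator {A : Set} {_∙_ : A → A → A} {ε : A} (isCommMonoid : IsCommutativeMonoid _≡_ _∙_ ε) where
  open IsCommutativeMonoid isCommMonoid using (assoc; identityˡ; identityʳ)

  private
    commutativeSemigroup : CommutativeSemigroup _ _
    commutativeSemigroup = record { isCommutativeSemigroup = IsCommutativeMonoid.isCommutativeSemigroup isCommMonoid }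

  open CommutativeSemigroupProperties commutativeSemigroup using (interchange)

  ⨁ : (m : ℕ) → (BV m → A) → A
  ⨁ ℕ.zero    g = g []
  ⨁ (ℕ.suc m) g = ⨁ m (λ v → g (false ∷ v) ∙ g (true ∷ v))

  foldr-allBV : ∀ m (g : BV m → A) → foldr _∙_ ε (map g (allBV m)) ≡ ⨁ m g
  foldr-allBV ℕ.zero    g = identityʳ (g [])
  foldr-allBV (ℕ.suc m) g = trans (doubling (allBV m)) (foldr-allBV m _)
    where
    doubling : ∀ vs → foldr _∙_ ε (map g (concatMap (λ v → (false ∷ v) List.∷ (true ∷ v) List.∷ List.[]) vs))
                    ≡ foldr _∙_ ε (map (λ v → g (false ∷ v) ∙ g (true ∷ v)) vs)
    doubling List.[]       = refl
    doubling (v List.∷ vs) = trans (cong (λ r → g (false ∷ v) ∙ (g (true ∷ v) ∙ r)) (doubling vs))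
                                   (sym (assoc _ _ _))

  ⨁-cong : ∀ m {f g : BV m → A} → (∀ x → f x ≡ g x) → ⨁ m f ≡ ⨁ m g
  ⨁-cong ℕ.zero    f≗g = f≗g []
  ⨁-cong (ℕ.suc m) f≗g = ⨁-cong m (λ v → cong₂ _∙_ (f≗g _) (f≗g _))

  ⨁-ε : ∀ m → ⨁ m (λ _ → ε) ≡ ε
  ⨁-ε ℕ.zero    = refl
  ⨁-ε (ℕ.suc m) = trans (⨁-cong m (λ _ → identityʳ ε)) (⨁-ε m)

  ⨁-single : ∀ m (g : BV m → A) a → (∀ x → x ≢ a → g x ≡ ε) → ⨁ m g ≡ g a
  ⨁-single ℕ.zero    g []      _    = refl
  ⨁-single (ℕ.suc m) g (false ∷ a) off = trans
    (⨁-single m _ a (λ x x≢a →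
      trans (cong₂ _∙_ (off _ (x≢a ∘ VecP.∷-injectiveʳ)) (off _ λ ())) (identityʳ ε)))
    (trans (cong (g (false ∷ a) ∙_) (off _ λ ())) (identityʳ _))
  ⨁-single (ℕ.suc m) g (true ∷ a)  off = trans
    (⨁-single m _ a (λ x x≢a →
      trans (cong₂ _∙_ (off _ λ ()) (off _ (x≢a ∘ VecP.∷-injectiveʳ))) (identityʳ ε)))
    (trans (cong (_∙ g (true ∷ a)) (off _ λ ())) (identityˡ _))

  ⨁-distrib : ∀ m (f g : BV m → A) → ⨁ m (λ x → f x ∙ g x) ≡ ⨁ m f ∙ ⨁ m g
  ⨁-distrib ℕ.zero    f g = refl
  ⨁-distrib (ℕ.suc m) f g = trans (⨁-cong m (λ v → interchange _ _ _ _)) (⨁-distrib m _ _)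

  ⨁-swap : ∀ m n (F : BV m → BV n → A) → ⨁ m (λ x → ⨁ n (F x)) ≡ ⨁ n (λ y → ⨁ m (λ x → F x y))
  ⨁-swap ℕ.zero    n F = refl
  ⨁-swap (ℕ.suc m) n F = trans (⨁-cong m (λ v → sym (⨁-distrib n (F (false ∷ v)) (F (true ∷ v)))))
                                (⨁-swap m n _)

  ⨁-++ : ∀ m n (f : BV (m + n) → A) → ⨁ (m + n) f ≡ ⨁ m (λ x → ⨁ n (λ y → f (x ++ y)))
  ⨁-++ ℕ.zero    n f = refl
  ⨁-++ (ℕ.suc m) n f = trans (⨁-++ m n _) (⨁-cong m (λ x → ⨁-distrib n _ _))

open BigOperator ℤ.+-0-isCommutativeMonoid
  renaming ( ⨁ to ∑; foldr-allBV to foldr-+-allBV; ⨁-cong to ∑-cong; ⨁-ε to ∑-0; ⨁-single to ∑-single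
           ; ⨁-distrib to ∑-distrib; ⨁-swap to ∑-swap; ⨁-++ to ∑-++)

module XorSum = BigOperator (CommutativeRing.+-isCommutativeMonoid BoolP.xor-∧-commutativeRing)

∑-*ˡ : ∀ m c (f : BV m → ℤ) → ∑ m (λ x → c *ℤ f x) ≡ c *ℤ ∑ m f
∑-*ˡ ℕ.zero    c f = refl
∑-*ˡ (ℕ.suc m) c f = trans (∑-cong m (λ v → sym (ℤ.*-distribˡ-+ c (f (false ∷ v)) (f (true ∷ v)))))
                            (∑-*ˡ m c _)

∑-*ʳ : ∀ m c (f : BV m → ℤ) → ∑ m (λ x → f x *ℤ c) ≡ ∑ m f *ℤ c
∑-*ʳ m c f = trans (∑-cong m (λ x → ℤ.*-comm (f x) c)) (trans (∑-*ˡ m c f) (ℤ.*-comm c _))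

∑-const : ∀ m c → ∑ m (λ _ → c) ≡ pow2 m *ℤ c
∑-const ℕ.zero    c = sym (ℤ.*-identityˡ c)
∑-const (ℕ.suc m) c = trans (∑-const m (c +ℤ c)) (begin
  pow2 m *ℤ (c +ℤ c)        ≡⟨ double (pow2 m) c ⟩
  (+ 2 *ℤ pow2 m) *ℤ c      ≡⟨ cong (_*ℤ c) (ℤ.pos-* 2 (2 ^ m)) ⟨
  pow2 (ℕ.suc m) *ℤ c       ∎)
  where
  open ≡-Reasoning
  double : ∀ p c → p *ℤ (c +ℤ c) ≡ (+ 2 *ℤ p) *ℤ c
  double = solve-∀

any? : ∀ k {P : BV k → Set} → U.Decidable P → Dec (∃ P)
any? ℕ.zero    P? = Dec.map′ ([] ,_) (λ { ([] , p) → p }) (P? [])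
any? (ℕ.suc k) P? = Dec.map′
  (λ { (inj₁ (c , p)) → false ∷ c , p ; (inj₂ (c , p)) → true ∷ c , p })
  (λ { (false ∷ c , p) → inj₁ (c , p) ; (true ∷ c , p) → inj₂ (c , p) })
  (any? k (P? ∘ (false ∷_)) ⊎-dec any? k (P? ∘ (true ∷_)))

∑-image : ∀ n k (g : BV n → ℤ) (e : BV k → BV n) → (∀ {c d} → e c ≡ e d → c ≡ d) →
          (∀ u → (∀ c → u ≢ e c) → g u ≡ + 0) → ∑ n g ≡ ∑ k (g ∘ e)
∑-image n k g e e-injective g-outside = begin
  ∑ n g                               ≡⟨ ∑-cong n (λ u → sym (fibre u)) ⟩
  ∑ n (λ u → ∑ k (λ c → g-at u c))    ≡⟨ ∑-swap n k _ ⟩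
  ∑ k (λ c → ∑ n (λ u → g-at u c))    ≡⟨ ∑-cong k (λ c → trans (∑-single n _ (e c) (g-at-≢ c)) (g-at-≡ c)) ⟩
  ∑ k (g ∘ e)                         ∎
  where
  open ≡-Reasoning
  g-at : BV n → BV k → ℤ
  g-at u c = if does (u ≟ᵥ e c) then g u else + 0
  g-at-≢ : ∀ c u → u ≢ e c → g-at u c ≡ + 0
  g-at-≢ c u u≢ec with u ≟ᵥ e c
  ... | yes u≡ec = contradiction u≡ec u≢ec
  ... | no _     = refl
  g-at-≡ : ∀ c → g-at (e c) c ≡ g (e c)
  g-at-≡ c with e c ≟ᵥ e c
  ... | yes _   = refl
  ... | no ec≢ec = contradiction refl ec≢ec
  fibre : ∀ u → ∑ k (g-at u) ≡ g u
  fibre u with any? k (λ c → u ≟ᵥ e c)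
  ... | yes (c , refl) = trans (∑-single k _ c (λ d d≢c → g-at-≢ d (e c) (d≢c ∘ sym ∘ e-injective))) (g-at-≡ c)
  ... | no ∄c = trans (∑-cong k (λ c → g-at-≢ c u (λ u≡ec → ∄c (c , u≡ec))))
                      (trans (∑-0 k) (sym (g-outside u (λ c u≡ec → ∄c (c , u≡ec)))))

W-∑ : ∀ (f : BF m) u → W f u ≡ ∑ m (λ x → sign (⟨ u , x ⟩ xor f x))
W-∑ {m} f u = foldr-+-allBV m _

W-cong : ∀ {f g : BF m} → f ≈ g → ∀ u → W f u ≡ W g u
W-cong {m} {f} {g} f≈g u = begin
  W f u                                    ≡⟨ W-∑ f u ⟩
  ∑ m (λ x → sign (⟨ u , x ⟩ xor f x))     ≡⟨ ∑-cong m (λ x → cong (λ b → sign (⟨ u , x ⟩ xor b)) (f≈g x)) ⟩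
  ∑ m (λ x → sign (⟨ u , x ⟩ xor g x))     ≡⟨ W-∑ g u ⟨
  W g u                                    ∎
  where open ≡-Reasoning

charSum : ∀ m → BV m → ℤ
charSum m w = ∑ m (λ y → sign ⟨ y , w ⟩)

charSum-𝟎 : ∀ m → charSum m 𝟎 ≡ pow2 m
charSum-𝟎 m = trans (∑-cong m (λ y → cong sign (⟨⟩-𝟎ʳ y))) (trans (∑-const m (+ 1)) (ℤ.*-identityʳ _))

charSum-≢𝟎 : ∀ m (w : BV m) → w ≢ 𝟎 → charSum m w ≡ + 0
charSum-≢𝟎 ℕ.zero    []          w≢𝟎 = contradiction refl w≢𝟎
charSum-≢𝟎 (ℕ.suc m) (true ∷ w)  _   = trans (∑-cong m (λ v → sign-not ⟨ v , w ⟩)) (∑-0 m)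
charSum-≢𝟎 (ℕ.suc m) (false ∷ w) w≢𝟎 = trans (∑-distrib m _ _) (cong₂ _+ℤ_ vanish vanish)
  where
  vanish : charSum m w ≡ + 0
  vanish = charSum-≢𝟎 m w (w≢𝟎 ∘ cong (false ∷_))

walsh-inversion : ∀ (f : BF m) y → ∑ m (λ u → W f u *ℤ sign ⟨ u , y ⟩) ≡ pow2 m *ℤ sign (f y)
walsh-inversion {m} f y = begin
  ∑ m (λ u → W f u *ℤ sign ⟨ u , y ⟩)
    ≡⟨ ∑-cong m (λ u → trans (cong (_*ℤ sign ⟨ u , y ⟩) (W-∑ f u)) (sym (∑-*ʳ m _ _))) ⟩
  ∑ m (λ u → ∑ m (λ x → sign (⟨ u , x ⟩ xor f x) *ℤ sign ⟨ u , y ⟩))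
    ≡⟨ ∑-swap m m _ ⟩
  ∑ m (λ x → ∑ m (λ u → sign (⟨ u , x ⟩ xor f x) *ℤ sign ⟨ u , y ⟩))
    ≡⟨ ∑-cong m (λ x → trans (∑-cong m (character-product x)) (∑-*ˡ m (sign (f x)) _)) ⟩
  ∑ m (λ x → sign (f x) *ℤ charSum m (x ⊕ y))
    ≡⟨ ∑-single m _ y (λ x x≢y → trans (cong (sign (f x) *ℤ_) (charSum-≢𝟎 m _ (x≢y ∘ ⊕.x∙y⁻¹≈ε⇒x≈y x y)))
                                       (ℤ.*-zeroʳ (sign (f x)))) ⟩
  sign (f y) *ℤ charSum m (y ⊕ y)
    ≡⟨ cong (λ w → sign (f y) *ℤ charSum m w) (⊕-self y) ⟩
  sign (f y) *ℤ charSum m 𝟎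
    ≡⟨ trans (cong (sign (f y) *ℤ_) (charSum-𝟎 m)) (ℤ.*-comm (sign (f y)) (pow2 m)) ⟩
  pow2 m *ℤ sign (f y) ∎
  where
  open ≡-Reasoning
  character-product : ∀ x u → sign (⟨ u , x ⟩ xor f x) *ℤ sign ⟨ u , y ⟩ ≡ sign (f x) *ℤ sign ⟨ u , x ⊕ y ⟩
  character-product x u
    rewrite sign-xor ⟨ u , x ⟩ (f x) | ⟨⟩-⊕ʳ u x y | sign-xor ⟨ u , x ⟩ ⟨ u , y ⟩ =
      rearrange (sign ⟨ u , x ⟩) (sign (f x)) (sign ⟨ u , y ⟩)
    where
    rearrange : ∀ a b c → (a *ℤ b) *ℤ c ≡ b *ℤ (a *ℤ c)
    rearrange = solve-∀

parseval : ∀ (f : BF m) → ∑ m (λ u → W f u *ℤ W f u) ≡ pow2 m *ℤ pow2 m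
parseval {m} f = begin
  ∑ m (λ u → W f u *ℤ W f u)
    ≡⟨ ∑-cong m (λ u → trans (cong (W f u *ℤ_) (W-∑ f u)) (sym (∑-*ˡ m (W f u) _))) ⟩
  ∑ m (λ u → ∑ m (λ x → W f u *ℤ sign (⟨ u , x ⟩ xor f x)))
    ≡⟨ ∑-swap m m _ ⟩
  ∑ m (λ x → ∑ m (λ u → W f u *ℤ sign (⟨ u , x ⟩ xor f x)))
    ≡⟨ ∑-cong m (λ x → trans (∑-cong m (λ u → split-sign u x)) (∑-*ˡ m (sign (f x)) _)) ⟩
  ∑ m (λ x → sign (f x) *ℤ ∑ m (λ u → W f u *ℤ sign ⟨ u , x ⟩))
    ≡⟨ ∑-cong m (λ x → trans (cong (sign (f x) *ℤ_) (walsh-inversion f x)) (cancel-sign (f x))) ⟩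
  ∑ m (λ _ → pow2 m)
    ≡⟨ ∑-const m (pow2 m) ⟩
  pow2 m *ℤ pow2 m ∎
  where
  open ≡-Reasoning
  split-sign : ∀ u x → W f u *ℤ sign (⟨ u , x ⟩ xor f x) ≡ sign (f x) *ℤ (W f u *ℤ sign ⟨ u , x ⟩)
  split-sign u x rewrite sign-xor ⟨ u , x ⟩ (f x) = rearrange (W f u) (sign ⟨ u , x ⟩) (sign (f x))
    where
    rearrange : ∀ w a b → w *ℤ (a *ℤ b) ≡ b *ℤ (w *ℤ a)
    rearrange = solve-∀
  cancel-sign : ∀ p → sign p *ℤ (pow2 m *ℤ sign p) ≡ pow2 m
  cancel-sign p = trans (rearrange (sign p) (pow2 m))
                        (trans (cong (pow2 m *ℤ_) (sign-sq p)) (ℤ.*-identityʳ (pow2 m)))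
    where
    rearrange : ∀ s P → s *ℤ (P *ℤ s) ≡ P *ℤ (s *ℤ s)
    rearrange = solve-∀

walsh-injective : ∀ {f g : BF m} → (∀ u → W f u ≡ W g u) → f ≈ g
walsh-injective {m} {f} {g} W≡W y = sign-injective (pow2-cancelˡ m (begin
  pow2 m *ℤ sign (f y)                   ≡⟨ walsh-inversion f y ⟨
  ∑ m (λ u → W f u *ℤ sign ⟨ u , y ⟩)     ≡⟨ ∑-cong m (λ u → cong (_*ℤ sign ⟨ u , y ⟩) (W≡W u)) ⟩
  ∑ m (λ u → W g u *ℤ sign ⟨ u , y ⟩)     ≡⟨ walsh-inversion g y ⟩
  pow2 m *ℤ sign (g y)                   ∎))
  where open ≡-Reasoning

WalshSupport : BF m → Subset m → Set
WalshSupport f C = ∀ u → (W f u ≢ + 0) ⇔ (C u ≡ true)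

W-outside-support : ∀ {f : BF m} {C} → WalshSupport f C → ∀ u → C u ≢ true → W f u ≡ + 0
W-outside-support {f = f} supp u u∉C =
  Dec.decidable-stable (W f u ℤ.≟ + 0) (λ W≢0 → u∉C (Equivalence.to (supp u) W≢0))

WalshSupport-unique : ∀ {f g : BF m} {C D} → f ≈ g → WalshSupport f C → WalshSupport g D → ∀ u → C u ≡ D u
WalshSupport-unique {f = f} {g} {C} {D} f≈g f-supp g-supp u = bool-ext C⇒D D⇒C
  where
  C⇒D : C u ≡ true → D u ≡ true
  C⇒D u∈C = Equivalence.to (g-supp u) (Equivalence.from (f-supp u) u∈C ∘ trans (W-cong f≈g u))
  D⇒C : D u ≡ true → C u ≡ true
  D⇒C u∈D = Equivalence.to (f-supp u) (Equivalence.from (g-supp u) u∈D ∘ trans (sym (W-cong f≈g u)))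
  bool-ext : ∀ {p q} → (p ≡ true → q ≡ true) → (q ≡ true → p ≡ true) → p ≡ q
  bool-ext {false} {false} _ _ = refl
  bool-ext {false} {true}  _ q⇒p = q⇒p refl
  bool-ext {true}  {false} p⇒q _ = sym (p⇒q refl)
  bool-ext {true}  {true}  _ _ = refl

module AffineLift {n k m : ℕ} (k+m≡n : k + m ≡ n) {A : Subset n} (A-affine : IsAffine n k A) where

  a₀ : BV n
  a₀ = proj₁ A-affine

  vs : Vec (BV n) k
  vs = proj₁ (proj₂ A-affine)

  point : BV k → BV n
  point c = a₀ ⊕ lincomb c vs

  point-injective : ∀ {c d} → point c ≡ point d → c ≡ d
  point-injective {c} {d} eq =
    lincomb-injective (proj₁ (proj₂ (proj₂ A-affine))) c d (⊕.∙-cancelˡ a₀ _ _ eq)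

  point∈A : ∀ c → A (point c) ≡ true
  point∈A c = Equivalence.from (proj₂ (proj₂ (proj₂ A-affine)) (point c)) (c , refl)

  A⇒point : ∀ {u} → A u ≡ true → ∃[ c ] u ≡ point c
  A⇒point {u} = Equivalence.to (proj₂ (proj₂ (proj₂ A-affine)) u)

  ∉points⇒∉A : ∀ {u} → (∀ c → u ≢ point c) → A u ≢ true
  ∉points⇒∉A u∉ u∈A = let (c , u≡c) = A⇒point u∈A in u∉ c u≡c

  point? : ∀ u → Dec (∃[ c ] u ≡ point c)
  point? u = any? k (λ c → u ≟ᵥ point c)

  lift : BF k → BF n
  lift h y = ⟨ a₀ , y ⟩ xor h (coords vs y)

  offset-𝟎⇒point : ∀ u d → (u ⊕ a₀) ⊕ lincomb d vs ≡ 𝟎 → u ≡ point d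
  offset-𝟎⇒point u d eq = trans (⊕.x≈z//y u a₀ (lincomb d vs) (⊕.x∙y⁻¹≈ε⇒x≈y _ _ eq)) (⊕-comm _ a₀)

  offset-point : ∀ d → (point d ⊕ a₀) ⊕ lincomb d vs ≡ 𝟎
  offset-point d = trans (cong (_⊕ lincomb d vs) (⊕.xyx⁻¹≈y a₀ (lincomb d vs))) (⊕-self _)

  -- Expanding h by Walsh inversion turns W (lift h) u into a sum of character sums.
  W-lift-scaled : ∀ h u → pow2 k *ℤ W (lift h) u ≡ ∑ k (λ d → W h d *ℤ charSum n ((u ⊕ a₀) ⊕ lincomb d vs))
  W-lift-scaled h u = begin
    pow2 k *ℤ W (lift h) u
      ≡⟨ trans (cong (pow2 k *ℤ_) (W-∑ (lift h) u)) (sym (∑-*ˡ n (pow2 k) _)) ⟩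
    ∑ n (λ y → pow2 k *ℤ sign (⟨ u , y ⟩ xor lift h y))
      ≡⟨ ∑-cong n separate ⟩
    ∑ n (λ y → sign ⟨ u ⊕ a₀ , y ⟩ *ℤ (pow2 k *ℤ sign (h (coords vs y))))
      ≡⟨ ∑-cong n (λ y → cong (sign ⟨ u ⊕ a₀ , y ⟩ *ℤ_) (sym (walsh-inversion h (coords vs y)))) ⟩
    ∑ n (λ y → sign ⟨ u ⊕ a₀ , y ⟩ *ℤ ∑ k (λ d → W h d *ℤ sign ⟨ d , coords vs y ⟩))
      ≡⟨ ∑-cong n (λ y → trans (sym (∑-*ˡ k (sign ⟨ u ⊕ a₀ , y ⟩) _)) (∑-cong k (merge y))) ⟩
    ∑ n (λ y → ∑ k (λ d → W h d *ℤ sign ⟨ y , (u ⊕ a₀) ⊕ lincomb d vs ⟩))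
      ≡⟨ ∑-swap n k _ ⟩
    ∑ k (λ d → ∑ n (λ y → W h d *ℤ sign ⟨ y , (u ⊕ a₀) ⊕ lincomb d vs ⟩))
      ≡⟨ ∑-cong k (λ d → ∑-*ˡ n (W h d) _) ⟩
    ∑ k (λ d → W h d *ℤ charSum n ((u ⊕ a₀) ⊕ lincomb d vs)) ∎
    where
    open ≡-Reasoning
    separate : ∀ y → pow2 k *ℤ sign (⟨ u , y ⟩ xor lift h y)
                   ≡ sign ⟨ u ⊕ a₀ , y ⟩ *ℤ (pow2 k *ℤ sign (h (coords vs y)))
    separate y rewrite sign-xor ⟨ u , y ⟩ (lift h y) | sign-xor ⟨ a₀ , y ⟩ (h (coords vs y))
                     | ⟨⟩-⊕ˡ u a₀ y | sign-xor ⟨ u , y ⟩ ⟨ a₀ , y ⟩ =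
      rearrange (pow2 k) (sign ⟨ u , y ⟩) (sign ⟨ a₀ , y ⟩) (sign (h (coords vs y)))
      where
      rearrange : ∀ p s t r → p *ℤ (s *ℤ (t *ℤ r)) ≡ (s *ℤ t) *ℤ (p *ℤ r)
      rearrange = solve-∀
    merge : ∀ y d → sign ⟨ u ⊕ a₀ , y ⟩ *ℤ (W h d *ℤ sign ⟨ d , coords vs y ⟩)
                  ≡ W h d *ℤ sign ⟨ y , (u ⊕ a₀) ⊕ lincomb d vs ⟩
    merge y d rewrite sym (⟨⟩-lincomb d vs y) | ⟨⟩-comm y ((u ⊕ a₀) ⊕ lincomb d vs)
                    | ⟨⟩-⊕ˡ (u ⊕ a₀) (lincomb d vs) y | sign-xor ⟨ u ⊕ a₀ , y ⟩ ⟨ lincomb d vs , y ⟩ =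
      rearrange (sign ⟨ u ⊕ a₀ , y ⟩) (W h d) (sign ⟨ lincomb d vs , y ⟩)
      where
      rearrange : ∀ s w t → s *ℤ (w *ℤ t) ≡ w *ℤ (s *ℤ t)
      rearrange = solve-∀

  W-lift-point : ∀ h c → W (lift h) (point c) ≡ W h c *ℤ pow2 m
  W-lift-point h c = pow2-cancelˡ k (begin
    pow2 k *ℤ W (lift h) (point c)
      ≡⟨ W-lift-scaled h (point c) ⟩
    ∑ k (λ d → W h d *ℤ charSum n ((point c ⊕ a₀) ⊕ lincomb d vs))
      ≡⟨ ∑-single k _ c other ⟩
    W h c *ℤ charSum n ((point c ⊕ a₀) ⊕ lincomb c vs)
      ≡⟨ cong (λ w → W h c *ℤ charSum n w) (offset-point c) ⟩
    W h c *ℤ charSum n 𝟎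
      ≡⟨ cong (W h c *ℤ_) (trans (charSum-𝟎 n) (cong pow2 (sym k+m≡n))) ⟩
    W h c *ℤ pow2 (k + m)
      ≡⟨ cong (W h c *ℤ_) (pow2-+ k m) ⟩
    W h c *ℤ (pow2 k *ℤ pow2 m)
      ≡⟨ rearrange (W h c) (pow2 k) (pow2 m) ⟩
    pow2 k *ℤ (W h c *ℤ pow2 m) ∎)
    where
    open ≡-Reasoning
    other : ∀ d → d ≢ c → W h d *ℤ charSum n ((point c ⊕ a₀) ⊕ lincomb d vs) ≡ + 0
    other d d≢c = trans (cong (W h d *ℤ_) (charSum-≢𝟎 n _ (d≢c ∘ sym ∘ point-injective ∘ offset-𝟎⇒point (point c) d)))
                        (ℤ.*-zeroʳ (W h d))
    rearrange : ∀ w a b → w *ℤ (a *ℤ b) ≡ a *ℤ (w *ℤ b)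
    rearrange = solve-∀

  W-lift-outside : ∀ h u → (∀ c → u ≢ point c) → W (lift h) u ≡ + 0
  W-lift-outside h u u∉ = pow2-cancelˡ k (begin
    pow2 k *ℤ W (lift h) u                                            ≡⟨ W-lift-scaled h u ⟩
    ∑ k (λ d → W h d *ℤ charSum n ((u ⊕ a₀) ⊕ lincomb d vs))          ≡⟨ ∑-cong k vanish ⟩
    ∑ k (λ _ → + 0)                                                   ≡⟨ ∑-0 k ⟩
    + 0                                                               ≡⟨ ℤ.*-zeroʳ (pow2 k) ⟨
    pow2 k *ℤ + 0                                                     ∎)
    where
    open ≡-Reasoning
    vanish : ∀ d → W h d *ℤ charSum n ((u ⊕ a₀) ⊕ lincomb d vs) ≡ + 0
    vanish d = trans (cong (W h d *ℤ_) (charSum-≢𝟎 n _ (u∉ d ∘ offset-𝟎⇒point u d))) (ℤ.*-zeroʳ (W h d))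

  -- Parseval: the 2^k points of A share the whole mass 2^(2n), which fixes the plateau level.
  plateaued-level : ∀ {f} → Plateaued n f → WalshSupport f A → ∀ u → A u ≡ true → W f u *ℤ W f u ≡ pow2 (m + n)
  plateaued-level {f} (e , values) supp u u∈A = trans (square-on-A u u∈A) (cong pow2 e+e≡m+n)
    where
    open ≡-Reasoning
    square-on-A : ∀ u → A u ≡ true → W f u *ℤ W f u ≡ pow2 (e + e)
    square-on-A u u∈A with values u
    ... | inj₁ W≡0 = contradiction W≡0 (Equivalence.from (supp u) u∈A)
    ... | inj₂ W≡± = ±pow2-square e W≡±
    mass : pow2 (n + n) ≡ pow2 (k + (e + e))
    mass = begin
      pow2 (n + n)                                 ≡⟨ pow2-+ n n ⟩
      pow2 n *ℤ pow2 n                             ≡⟨ parseval f ⟨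
      ∑ n (λ u → W f u *ℤ W f u)                   ≡⟨ ∑-image n k _ point point-injective
                                                        (λ u u∉ → cong (λ w → w *ℤ w) (W-outside-support supp u (∉points⇒∉A u∉))) ⟩
      ∑ k (λ c → W f (point c) *ℤ W f (point c))   ≡⟨ ∑-cong k (λ c → square-on-A (point c) (point∈A c)) ⟩
      ∑ k (λ _ → pow2 (e + e))                     ≡⟨ ∑-const k (pow2 (e + e)) ⟩
      pow2 k *ℤ pow2 (e + e)                       ≡⟨ pow2-+ k (e + e) ⟨
      pow2 (k + (e + e))                           ∎
    e+e≡m+n : e + e ≡ m + n
    e+e≡m+n = ℕ.+-cancelˡ-≡ k _ _ (begin
      k + (e + e)   ≡⟨ pow2-injective mass ⟨
      n + n         ≡⟨ cong (_+ n) k+m≡n ⟨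
      (k + m) + n   ≡⟨ ℕ.+-assoc k m n ⟩
      k + (m + n)   ∎)

  W-lift-point-± : ∀ {t h} → k ≡ t + t → Bent k h → ∀ c →
                   W (lift h) (point c) ≡ pow2 (t + m) ⊎ W (lift h) (point c) ≡ - pow2 (t + m)
  W-lift-point-± {t} {h} k≡t+t bent c
    with i*i≡n*n⇒i≡±n (W h c) (2 ^ t) (trans (bent c) (trans (cong pow2 k≡t+t) (pow2-+ t t)))
  ... | inj₁ W≡ = inj₁ (trans (W-lift-point h c) (trans (cong (_*ℤ pow2 m) W≡) (sym (pow2-+ t m))))
  ... | inj₂ W≡ = inj₂ (trans (W-lift-point h c) (trans (cong (_*ℤ pow2 m) W≡)
                    (trans (sym (ℤ.neg-distribˡ-* (pow2 t) (pow2 m))) (cong -_ (sym (pow2-+ t m))))))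

  lift-plateaued : ∀ {t h} → k ≡ t + t → Bent k h → Plateaued n (lift h) × WalshSupport (lift h) A
  lift-plateaued {t} {h} k≡t+t bent = (t + m , values) , λ u → mk⇔ (W≢0⇒∈A u) (∈A⇒W≢0 u)
    where
    values : ∀ u → W (lift h) u ≡ + 0 ⊎ W (lift h) u ≡ pow2 (t + m) ⊎ W (lift h) u ≡ - pow2 (t + m)
    values u with point? u
    ... | yes (c , refl) = inj₂ (W-lift-point-± {t} k≡t+t bent c)
    ... | no ∄c          = inj₁ (W-lift-outside h u (λ c u≡c → ∄c (c , u≡c)))
    W≢0⇒∈A : ∀ u → W (lift h) u ≢ + 0 → A u ≡ true
    W≢0⇒∈A u W≢0 with point? u
    ... | yes (c , refl) = point∈A c
    ... | no ∄c          = contradiction (W-lift-outside h u (λ c u≡c → ∄c (c , u≡c))) W≢0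
    ∈A⇒W≢0 : ∀ u → A u ≡ true → W (lift h) u ≢ + 0
    ∈A⇒W≢0 u u∈A with A⇒point u∈A
    ... | c , refl = ±pow2≢0 (t + m) (W-lift-point-± {t} k≡t+t bent c)

  lift-cong : ∀ {h h′} → h ≈ h′ → lift h ≈ lift h′
  lift-cong h≈h′ y = cong (⟨ a₀ , y ⟩ xor_) (h≈h′ (coords vs y))

  lift-injective : ∀ {h h′} → lift h ≈ lift h′ → h ≈ h′
  lift-injective {h} {h′} lift≈ = walsh-injective (λ c → pow2-cancelʳ m (begin
    W h c *ℤ pow2 m          ≡⟨ W-lift-point h c ⟨
    W (lift h) (point c)     ≡⟨ W-cong lift≈ (point c) ⟩
    W (lift h′) (point c)    ≡⟨ W-lift-point h′ c ⟩
    W h′ c *ℤ pow2 m         ∎))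
    where open ≡-Reasoning

  -- The inverse Walsh transform of c ↦ W f (point c); its sign at z is the value at z of the h with f ≈ lift h.
  unlift : BF n → BF k
  unlift f z = negative (∑ k (λ c → W f (point c) *ℤ sign ⟨ c , z ⟩))

  inversion-on-A : ∀ {f} → WalshSupport f A → ∀ y →
                   ∑ k (λ c → W f (point c) *ℤ sign ⟨ c , coords vs y ⟩) ≡ pow2 n *ℤ sign (⟨ a₀ , y ⟩ xor f y)
  inversion-on-A {f} supp y = begin
    ∑ k (λ c → W f (point c) *ℤ sign ⟨ c , coords vs y ⟩)
      ≡⟨ ∑-cong k shift ⟩
    ∑ k (λ c → sign ⟨ a₀ , y ⟩ *ℤ (W f (point c) *ℤ sign ⟨ point c , y ⟩))
      ≡⟨ ∑-*ˡ k (sign ⟨ a₀ , y ⟩) _ ⟩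
    sign ⟨ a₀ , y ⟩ *ℤ ∑ k (λ c → W f (point c) *ℤ sign ⟨ point c , y ⟩)
      ≡⟨ cong (sign ⟨ a₀ , y ⟩ *ℤ_) (∑-image n k _ point point-injective outside) ⟨
    sign ⟨ a₀ , y ⟩ *ℤ ∑ n (λ u → W f u *ℤ sign ⟨ u , y ⟩)
      ≡⟨ cong (sign ⟨ a₀ , y ⟩ *ℤ_) (walsh-inversion f y) ⟩
    sign ⟨ a₀ , y ⟩ *ℤ (pow2 n *ℤ sign (f y))
      ≡⟨ rearrange (sign ⟨ a₀ , y ⟩) (pow2 n) (sign (f y)) ⟩
    pow2 n *ℤ (sign ⟨ a₀ , y ⟩ *ℤ sign (f y))
      ≡⟨ cong (pow2 n *ℤ_) (sign-xor ⟨ a₀ , y ⟩ (f y)) ⟨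
    pow2 n *ℤ sign (⟨ a₀ , y ⟩ xor f y) ∎
    where
    open ≡-Reasoning
    outside : ∀ u → (∀ c → u ≢ point c) → W f u *ℤ sign ⟨ u , y ⟩ ≡ + 0
    outside u u∉ = trans (cong (_*ℤ sign ⟨ u , y ⟩) (W-outside-support supp u (∉points⇒∉A u∉)))
                         (ℤ.*-zeroˡ (sign ⟨ u , y ⟩))
    rearrange : ∀ a b c → a *ℤ (b *ℤ c) ≡ b *ℤ (a *ℤ c)
    rearrange = solve-∀
    shift : ∀ c → W f (point c) *ℤ sign ⟨ c , coords vs y ⟩
                ≡ sign ⟨ a₀ , y ⟩ *ℤ (W f (point c) *ℤ sign ⟨ point c , y ⟩)
    shift c rewrite ⟨⟩-⊕ˡ a₀ (lincomb c vs) y | sign-xor ⟨ a₀ , y ⟩ ⟨ lincomb c vs , y ⟩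
                  | ⟨⟩-lincomb c vs y = begin
      w *ℤ s                 ≡⟨ cong (w *ℤ_) (ℤ.*-identityˡ s) ⟨
      w *ℤ (+ 1 *ℤ s)        ≡⟨ cong (λ o → w *ℤ (o *ℤ s)) (sign-sq ⟨ a₀ , y ⟩) ⟨
      w *ℤ ((a *ℤ a) *ℤ s)   ≡⟨ reassociate a w s ⟩
      a *ℤ (w *ℤ (a *ℤ s))   ∎
      where
      w s a : ℤ
      w = W f (point c)
      s = sign ⟨ c , coords vs y ⟩
      a = sign ⟨ a₀ , y ⟩
      reassociate : ∀ a w s → w *ℤ ((a *ℤ a) *ℤ s) ≡ a *ℤ (w *ℤ (a *ℤ s))
      reassociate = solve-∀

  lift-unlift : ∀ {f} → WalshSupport f A → f ≈ lift (unlift f)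
  lift-unlift {f} supp y = sym (begin
    ⟨ a₀ , y ⟩ xor unlift f (coords vs y)
      ≡⟨ cong (λ i → ⟨ a₀ , y ⟩ xor negative i) (inversion-on-A supp y) ⟩
    ⟨ a₀ , y ⟩ xor negative (pow2 n *ℤ sign (⟨ a₀ , y ⟩ xor f y))
      ≡⟨ cong (⟨ a₀ , y ⟩ xor_) (negative-pow2*sign n _) ⟩
    ⟨ a₀ , y ⟩ xor (⟨ a₀ , y ⟩ xor f y)
      ≡⟨ xor-cancelˡ ⟨ a₀ , y ⟩ (f y) ⟩
    f y ∎)
    where open ≡-Reasoning

  unlift-bent : ∀ {f} → Plateaued n f → WalshSupport f A → Bent k (unlift f)
  unlift-bent {f} plateaued supp c = pow2-cancelˡ m (pow2-cancelˡ m (begin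
    pow2 m *ℤ (pow2 m *ℤ (w *ℤ w))          ≡⟨ rearrange (pow2 m) w ⟩
    (w *ℤ pow2 m) *ℤ (w *ℤ pow2 m)          ≡⟨ cong (λ i → i *ℤ i) W-at-point ⟨
    W f (point c) *ℤ W f (point c)          ≡⟨ plateaued-level plateaued supp (point c) (point∈A c) ⟩
    pow2 (m + n)                            ≡⟨ cong (λ e → pow2 (m + e)) (trans (sym k+m≡n) (ℕ.+-comm k m)) ⟩
    pow2 (m + (m + k))                      ≡⟨ trans (pow2-+ m (m + k)) (cong (pow2 m *ℤ_) (pow2-+ m k)) ⟩
    pow2 m *ℤ (pow2 m *ℤ pow2 k)            ∎))
    where
    open ≡-Reasoning
    w : ℤ
    w = W (unlift f) c
    W-at-point : W f (point c) ≡ w *ℤ pow2 m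
    W-at-point = trans (W-cong (lift-unlift supp) (point c)) (W-lift-point (unlift f) c)
    rearrange : ∀ p w → p *ℤ (p *ℤ (w *ℤ w)) ≡ (w *ℤ p) *ℤ (w *ℤ p)
    rearrange = solve-∀

uncurry++ : ∀ {n₁ n₂} → (BV n₁ → BF n₂) → BF (n₁ + n₂)
uncurry++ {ℕ.zero}  F z       = F [] z
uncurry++ {ℕ.suc _} F (b ∷ z) = uncurry++ (F ∘ (b ∷_)) z

uncurry++-++ : ∀ {n₁ n₂} (F : BV n₁ → BF n₂) x y → uncurry++ F (x ++ y) ≡ F x y
uncurry++-++ F []      y = refl
uncurry++-++ F (b ∷ x) y = uncurry++-++ (F ∘ (b ∷_)) x y

≈-from-++ : ∀ {n₁ n₂} {g h : BF (n₁ + n₂)} → (∀ x y → g (x ++ y) ≡ h (x ++ y)) → g ≈ h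
≈-from-++ {n₁} g≡h z with Vec.splitAt n₁ z
... | x , y , refl = g≡h x y

pw-refl : ∀ (x : BV m) → pw x x ≡ true
pw-refl []          = refl
pw-refl (false ∷ x) = pw-refl x
pw-refl (true ∷ x)  = pw-refl x

pw-≢ : ∀ (x a : BV m) → x ≢ a → pw x a ≡ false
pw-≢ []          []          x≢a = contradiction refl x≢a
pw-≢ (false ∷ x) (true ∷ a)  _   = refl
pw-≢ (true ∷ x)  (false ∷ a) _   = refl
pw-≢ (false ∷ x) (false ∷ a) x≢a = pw-≢ x a (x≢a ∘ cong (false ∷_))
pw-≢ (true ∷ x)  (true ∷ a)  x≢a = pw-≢ x a (x≢a ∘ cong (true ∷_))

constrK-eval : ∀ {n₁ n₂} (fs : BV n₁ → BF n₂) x y → constrK fs x y ≡ fs x y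
constrK-eval {n₁} fs x y = begin
  constrK fs x y                        ≡⟨ XorSum.foldr-allBV n₁ _ ⟩
  XorSum.⨁ n₁ (λ a → fs a y ∧ pw x a)   ≡⟨ XorSum.⨁-single n₁ _ x other ⟩
  fs x y ∧ pw x x                       ≡⟨ cong (fs x y ∧_) (pw-refl x) ⟩
  fs x y ∧ true                         ≡⟨ BoolP.∧-identityʳ (fs x y) ⟩
  fs x y                                ∎
  where
  open ≡-Reasoning
  other : ∀ a → a ≢ x → fs a y ∧ pw x a ≡ false
  other a a≢x = trans (cong (fs a y ∧_) (pw-≢ x a (a≢x ∘ sym))) (BoolP.∧-zeroʳ (fs a y))

W-++ : ∀ {n₁ n₂} (g : BF (n₁ + n₂)) (F : BV n₁ → BF n₂) → (∀ x y → g (x ++ y) ≡ F x y) →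
       ∀ u v → W g (u ++ v) ≡ ∑ n₁ (λ x → sign ⟨ u , x ⟩ *ℤ W (F x) v)
W-++ {n₁} {n₂} g F g≡F u v = begin
  W g (u ++ v)
    ≡⟨ trans (W-∑ g (u ++ v)) (∑-++ n₁ n₂ _) ⟩
  ∑ n₁ (λ x → ∑ n₂ (λ y → sign (⟨ u ++ v , x ++ y ⟩ xor g (x ++ y))))
    ≡⟨ ∑-cong n₁ (λ x → trans (∑-cong n₂ (split x)) (∑-*ˡ n₂ (sign ⟨ u , x ⟩) _)) ⟩
  ∑ n₁ (λ x → sign ⟨ u , x ⟩ *ℤ ∑ n₂ (λ y → sign (⟨ v , y ⟩ xor F x y)))
    ≡⟨ ∑-cong n₁ (λ x → cong (sign ⟨ u , x ⟩ *ℤ_) (W-∑ (F x) v)) ⟨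
  ∑ n₁ (λ x → sign ⟨ u , x ⟩ *ℤ W (F x) v) ∎
  where
  open ≡-Reasoning
  split : ∀ x y → sign (⟨ u ++ v , x ++ y ⟩ xor g (x ++ y)) ≡ sign ⟨ u , x ⟩ *ℤ sign (⟨ v , y ⟩ xor F x y)
  split x y rewrite ⟨⟩-++ u x v y | g≡F x y | BoolP.xor-assoc ⟨ u , x ⟩ ⟨ v , y ⟩ (F x y) =
    sign-xor ⟨ u , x ⟩ (⟨ v , y ⟩ xor F x y)

K-bent : ∀ {n₁ n₂} → n₁ ≤ n₂ → ∀ g → IsK n₁ n₂ g → Bent (n₁ + n₂) g
K-bent {n₁} {n₂} n₁≤n₂ g (C , fs , (C-affine , C-partition) , fs-ok , g≡K) w
  with Vec.splitAt n₁ w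
... | u , v , refl with C-partition v
... | a , v∈Ca , unique = begin
  W g (u ++ v) *ℤ W g (u ++ v)                                          ≡⟨ cong (λ i → i *ℤ i) W-at ⟩
  (sign ⟨ u , a ⟩ *ℤ W (fs a) v) *ℤ (sign ⟨ u , a ⟩ *ℤ W (fs a) v)      ≡⟨ rearrange (sign ⟨ u , a ⟩) (W (fs a) v) ⟩
  (sign ⟨ u , a ⟩ *ℤ sign ⟨ u , a ⟩) *ℤ (W (fs a) v *ℤ W (fs a) v)      ≡⟨ cong₂ _*ℤ_ (sign-sq ⟨ u , a ⟩) level ⟩
  + 1 *ℤ pow2 (n₁ + n₂)                                                 ≡⟨ ℤ.*-identityˡ (pow2 (n₁ + n₂)) ⟩
  pow2 (n₁ + n₂)                                                        ∎
  where
  open ≡-Reasoning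
  other : ∀ x → x ≢ a → sign ⟨ u , x ⟩ *ℤ W (fs x) v ≡ + 0
  other x x≢a = trans (cong (sign ⟨ u , x ⟩ *ℤ_) (W-outside-support (proj₂ (fs-ok x)) v (x≢a ∘ unique x)))
                      (ℤ.*-zeroʳ (sign ⟨ u , x ⟩))
  W-at : W g (u ++ v) ≡ sign ⟨ u , a ⟩ *ℤ W (fs a) v
  W-at = trans (W-++ g fs (λ x y → trans (g≡K x y) (constrK-eval fs x y)) u v) (∑-single n₁ _ a other)
  level : W (fs a) v *ℤ W (fs a) v ≡ pow2 (n₁ + n₂)
  level = AffineLift.plateaued-level (ℕ.m∸n+n≡m n₁≤n₂) (C-affine a)
            (proj₁ (fs-ok a)) (proj₂ (fs-ok a)) v v∈Ca
  rearrange : ∀ s x → (s *ℤ x) *ℤ (s *ℤ x) ≡ (s *ℤ s) *ℤ (x *ℤ x)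
  rearrange = solve-∀

HasCard-map : ∀ {A B : Set} {R : A → A → Set} {S : B → B → Set} {P : A → Set} {Q : B → Set} {k}
              (F : A → B) →
              (∀ {x} → P x → Q (F x)) →
              (∀ {x y} → P x → P y → S (F x) (F y) → R x y) →
              (∀ {z} → Q z → ∃[ x ] P x × (∀ {y} → R x y → S z (F y))) →
              HasCard R P k → HasCard S Q k
HasCard-map {S = S} {Q = Q} F preserves reflects covers (xs , P-xs , xs-injective , xs-covers) =
  F ∘ xs , preserves ∘ P-xs , (λ i j → xs-injective i j ∘ reflects (P-xs i) (P-xs j)) , cover
  where
  cover : ∀ z → Q z → ∃[ i ] S z (F (xs i))
  cover z Qz with covers Qz
  ... | x , Px , near with xs-covers x Px
  ...   | i , x≈xsᵢ = i , near x≈xsᵢ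

HasCard-× : ∀ {A B : Set} {R : A → A → Set} {S : B → B → Set} {P : A → Set} {Q : B → Set} {m n} →
            HasCard R P m → HasCard S Q n → HasCard (Pointwise R S) (P ⟨×⟩ Q) (m * n)
HasCard-× {A} {B} {R} {S} {P} {Q} {m} {n}
          (xs , P-xs , xs-injective , xs-covers) (ys , Q-ys , ys-injective , ys-covers) =
  zs , (λ l → P-xs _ , Q-ys _) , zs-injective , zs-covers
  where
  zs : Fin (m * n) → A × B
  zs l = let (i , j) = Fin.remQuot {m} n l in xs i , ys j
  zs-injective : ∀ l l′ → Pointwise R S (zs l) (zs l′) → l ≡ l′
  zs-injective l l′ (R-xs , S-ys) = begin
    l                                            ≡⟨ FinP.combine-remQuot {m} n l ⟨
    uncurry Fin.combine (Fin.remQuot {m} n l)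
      ≡⟨ cong₂ Fin.combine (xs-injective _ _ R-xs) (ys-injective _ _ S-ys) ⟩
    uncurry Fin.combine (Fin.remQuot {m} n l′)   ≡⟨ FinP.combine-remQuot {m} n l′ ⟩
    l′                                           ∎
    where open ≡-Reasoning
  zs-covers : ∀ z → (P ⟨×⟩ Q) z → ∃[ l ] Pointwise R S z (zs l)
  zs-covers (x , y) (Px , Qy) with xs-covers x Px | ys-covers y Qy
  ... | i , x≈xsᵢ | j , y≈ysⱼ =
    Fin.combine i j , subst (Pointwise R S (x , y) ∘ uncurry (λ i j → xs i , ys j))
                            (sym (FinP.remQuot-combine i j)) (x≈xsᵢ , y≈ysⱼ)

Allᶠ : ∀ {A : Set} n → (A → Set) → (BV n → A) → Set
Allᶠ n P σ = ∀ a → P (σ a)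

Pointwiseᶠ : ∀ {A : Set} n → (A → A → Set) → (BV n → A) → (BV n → A) → Set
Pointwiseᶠ n R σ τ = ∀ a → R (σ a) (τ a)

HasCard-Π : ∀ {A : Set} {R : A → A → Set} {P : A → Set} {b} →
            HasCard R P b → ∀ n → HasCard (Pointwiseᶠ n R) (Allᶠ n P) (b ^ 2 ^ n)
HasCard-Π {A} {R} {P} {b} card ℕ.zero =
  subst (HasCard (Pointwiseᶠ 0 R) (Allᶠ 0 P)) (sym (ℕ.*-identityʳ b))
    (HasCard-map {S = Pointwiseᶠ 0 R} {Q = Allᶠ 0 P} (λ x _ → x)
      (λ Px _ → Px) (λ _ _ R-all → R-all []) (λ P-all → _ , P-all [] , λ { r [] → r }) card)
HasCard-Π {A} {R} {P} {b} card (ℕ.suc n) =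
  subst (HasCard (Pointwiseᶠ (ℕ.suc n) R) (Allᶠ (ℕ.suc n) P)) (sym b^2^[1+n])
    (HasCard-map {S = Pointwiseᶠ (ℕ.suc n) R} {Q = Allᶠ (ℕ.suc n) P} join
    (λ (P₀ , P₁) → λ { (false ∷ v) → P₀ v ; (true ∷ v) → P₁ v })
    (λ _ _ R-all → (λ v → R-all (false ∷ v)) , (λ v → R-all (true ∷ v)))
    (λ P-all → (_ , _) , (P-all ∘ (false ∷_) , P-all ∘ (true ∷_)) ,
               λ { (R₀ , R₁) (false ∷ v) → R₀ v ; (R₀ , R₁) (true ∷ v) → R₁ v })
    (HasCard-× {R = Pointwiseᶠ n R} {S = Pointwiseᶠ n R} half half))
  where
  half : HasCard (Pointwiseᶠ n R) (Allᶠ n P) (b ^ 2 ^ n)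
  half = HasCard-Π {R = R} {P = P} card n
  join : (BV n → A) × (BV n → A) → BV (ℕ.suc n) → A
  join (σ₀ , σ₁) (false ∷ v) = σ₀ v
  join (σ₀ , σ₁) (true ∷ v)  = σ₁ v
  b^2^[1+n] : b ^ 2 ^ ℕ.suc n ≡ b ^ 2 ^ n * b ^ 2 ^ n
  b^2^[1+n] = trans (ℕ.^-distribˡ-+-* b (2 ^ n) (2 ^ n + 0))
                    (cong (λ e → b ^ 2 ^ n * b ^ e) (ℕ.+-identityʳ (2 ^ n)))

HasCard-Fin : ∀ n → HasCard _≡_ (λ (_ : Fin n) → ⊤) n
HasCard-Fin n = id , _ , (λ _ _ → id) , λ i _ → i , refl

module Counting {n₁ n₂ t b N : ℕ} (n₁≤n₂ : n₁ ≤ n₂) (k≡t+t : n₂ ∸ n₁ ≡ t + t)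
                (bents : HasCard _≈_ (Bent (n₂ ∸ n₁)) b)
                (partitions : HasCard _≈P_ (OrdPartition n₁ n₂) N) where

  k : ℕ
  k = n₂ ∸ n₁

  partition : Fin N → BV n₁ → Subset n₂
  partition = proj₁ partitions

  partition-ok : ∀ j → OrdPartition n₁ n₂ (partition j)
  partition-ok = proj₁ (proj₂ partitions)

  module Block (j : Fin N) (a : BV n₁) = AffineLift (ℕ.m∸n+n≡m n₁≤n₂) (proj₁ (partition-ok j) a)

  Parameters : Set
  Parameters = Fin N × (BV n₁ → BF k)

  Admissible : Parameters → Set
  Admissible = (λ _ → ⊤) ⟨×⟩ Allᶠ n₁ (Bent k)

  _∼_ : Parameters → Parameters → Set
  _∼_ = Pointwise _≡_ (Pointwiseᶠ n₁ _≈_)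

  blocks : Parameters → BV n₁ → BF n₂
  blocks (j , σ) a = Block.lift j a (σ a)

  K : Parameters → BF (n₁ + n₂)
  K = uncurry++ ∘ blocks

  K-isK : ∀ {jσ} → Admissible jσ → IsK n₁ n₂ (K jσ)
  K-isK {j , σ} (_ , σ-bent) =
    partition j , blocks (j , σ) , partition-ok j ,
    (λ a → Block.lift-plateaued j a {t} k≡t+t (σ-bent a)) ,
    λ x y → trans (uncurry++-++ (blocks (j , σ)) x y) (sym (constrK-eval (blocks (j , σ)) x y))

  K-injective : ∀ {jσ jσ′} → Admissible jσ → Admissible jσ′ → K jσ ≈ K jσ′ → jσ ∼ jσ′
  K-injective {j , σ} {j′ , σ′} (_ , σ-bent) (_ , σ′-bent) K≈K′ = j≡j′ , σ≈σ′ j≡j′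
    where
    blocks≈ : ∀ a → blocks (j , σ) a ≈ blocks (j′ , σ′) a
    blocks≈ a y = trans (sym (uncurry++-++ (blocks (j , σ)) a y))
                        (trans (K≈K′ (a ++ y)) (uncurry++-++ (blocks (j′ , σ′)) a y))
    j≡j′ : j ≡ j′
    j≡j′ = proj₁ (proj₂ (proj₂ partitions)) j j′ (λ a → WalshSupport-unique (blocks≈ a)
             (proj₂ (Block.lift-plateaued j a {t} k≡t+t (σ-bent a)))
             (proj₂ (Block.lift-plateaued j′ a {t} k≡t+t (σ′-bent a))))
    σ≈σ′ : j ≡ j′ → ∀ a → σ a ≈ σ′ a
    σ≈σ′ refl a = Block.lift-injective j a (blocks≈ a)

  K-cover : ∀ {g} → IsK n₁ n₂ g →
            ∃[ jσ ] Admissible jσ × (∀ {jσ′} → jσ ∼ jσ′ → g ≈ K jσ′)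
  K-cover {g} (C , fs , C-partition , fs-ok , g≡K) with proj₂ (proj₂ (proj₂ partitions)) C C-partition
  ... | j , C≈partition = (j , σ) , (_ , σ-bent) , near
    where
    support : ∀ a → WalshSupport (fs a) (partition j a)
    support a u = mk⇔ (λ W≢0 → trans (sym (C≈partition a u)) (Equivalence.to (proj₂ (fs-ok a) u) W≢0))
                      (λ u∈ → Equivalence.from (proj₂ (fs-ok a) u) (trans (C≈partition a u) u∈))
    σ : BV n₁ → BF k
    σ a = Block.unlift j a (fs a)
    σ-bent : Allᶠ n₁ (Bent k) σ
    σ-bent a = Block.unlift-bent j a (proj₁ (fs-ok a)) (support a)
    near : ∀ {jσ′} → (j , σ) ∼ jσ′ → g ≈ K jσ′
    near {.j , σ′} (refl , σ≈σ′) = ≈-from-++ {g = g} {h = K (j , σ′)} λ x y → begin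
      g (x ++ y)               ≡⟨ trans (g≡K x y) (constrK-eval fs x y) ⟩
      fs x y                   ≡⟨ Block.lift-unlift j x (support x) y ⟩
      Block.lift j x (σ x) y   ≡⟨ Block.lift-cong j x (σ≈σ′ x) y ⟩
      blocks (j , σ′) x y      ≡⟨ uncurry++-++ (blocks (j , σ′)) x y ⟨
      K (j , σ′) (x ++ y)      ∎
      where open ≡-Reasoning

  K-card : HasCard _≈_ (IsK n₁ n₂) (N * b ^ 2 ^ n₁)
  K-card = HasCard-map {S = _≈_} {Q = IsK n₁ n₂} K K-isK K-injective K-cover
    (HasCard-× {R = _≡_} {S = Pointwiseᶠ n₁ _≈_} (HasCard-Fin N) (HasCard-Π {R = _≈_} bents n₁))

theorem4 : (n₁ n₂ : ℕ) → n₁ ≤ n₂ → 2 ∣ (n₁ + n₂) → 2 ∣ (n₂ ∸ n₁) →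
    (b N : ℕ) →
    HasCard _≈_ (Bent (n₂ ∸ n₁)) b →
    HasCard _≈P_ (OrdPartition n₁ n₂) N →
    ((∀ g → IsK n₁ n₂ g → Bent (n₁ + n₂) g) ×
     HasCard _≈_ (IsK n₁ n₂) (b ^ (2 ^ n₁) * N))
-- The parity of n₁ + n₂ follows from that of n₂ ∸ n₁.
theorem4 n₁ n₂ n₁≤n₂ _ (divides t k≡t*2) b N bents partitions =
  K-bent n₁≤n₂ ,
  subst (HasCard _≈_ (IsK n₁ n₂)) (ℕ.*-comm N (b ^ 2 ^ n₁))
    (Counting.K-card {t = t} n₁≤n₂ k≡t+t bents partitions)
  where
  k≡t+t : n₂ ∸ n₁ ≡ t + t
  k≡t+t = trans k≡t*2 (trans (ℕ.*-comm t 2) (cong (λ e → t + e) (ℕ.+-identityʳ t)))
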